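{- Let $D=(V,E)$ be a transitive acyclic digraph, and let $\pi$ be an arrangement of $V(D)$ in which the vertices appear in non-increasing order of $d^+(v)-d^-(v)$. Then $\pi$ is a maximum arrangement of $D$.
   Context: $D$ is transitive if $(u,v),(v,w)\in E$ with $u\neq w$ implies $(u,w)\in E$, and acyclic if it has no directed cycle; $d^+(v),d^-(v)$ are out- and in-degree. An arrangement of an $n$-vertex digraph is a bijection $\pi:V\to\{1,\dots,n\}$, written $(v_1,\dots,v_n)$ when $\pi(v_i)=i$. For $1\le i\le n-1$, $c_i(\pi)$ is the number of edges with tail in $\{v_1,\dots,v_i\}$ and head in $\{v_{i+1},\dots,v_n\}$; the signature of $\pi$ is $(c_1,\dots,c_{n-1})$. An arrangement $\pi$ is maximum if $c_i(\pi)\ge c_i(\sigma)$ for every arrangement $\sigma$ of $D$ and every $i$. -}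

module Defs where

open import Data.Nat using (ℕ; zero; suc; _+_; _<ᵇ_; _≤ᵇ_)
open import Data.Fin using (Fin; toℕ)
import Data.Fin as F
open import Data.Fin.Permutation using (Permutation′; _⟨$⟩ʳ_)
open import Data.Bool using (Bool; true; false; _∧_; if_then_else_)
open import Data.Integer using (ℤ; +_; _-_) renaming (_≥_ to _≥ℤ_)
open import Data.Nat using (_<_; _≤_; _∸_; _≥_)
open import Relation.Binary.PropositionalEquality using (_≡_; _≢_)
open import Relation.Nullary using (¬_)

Σ[_] : (n : ℕ) → (Fin n → ℕ) → ℕ
Σ[ zero ] f = 0
Σ[ suc n ] f = f F.zero + Σ[ n ] (λ i → f (F.suc i))

[_] : Bool → ℕ
[ true ] = 1
[ false ] = 0

-- A digraph on vertex set Fin n (no multiple edges):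
-- E u v ≡ true means (u , v) is an edge.
Digraph : ℕ → Set
Digraph n = Fin n → Fin n → Bool

module _ {n : ℕ} (E : Digraph n) where

  data Walk⁺ : Fin n → Fin n → Set where
    edge : ∀ {u v} → E u v ≡ true → Walk⁺ u v
    _∷_  : ∀ {u v w} → E u v ≡ true → Walk⁺ v w → Walk⁺ u w

  Transitive : Set
  Transitive = ∀ u v w → E u v ≡ true → E v w ≡ true → u ≢ w → E u w ≡ true

  -- No directed cycle (equivalently, no closed directed walk).
  Acyclic : Set
  Acyclic = ∀ v → ¬ Walk⁺ v v

  outdeg : Fin n → ℕ
  outdeg v = Σ[ n ] (λ w → [ E v w ])

  indeg : Fin n → ℕ
  indeg v = Σ[ n ] (λ u → [ E u v ])

  degDiff : Fin n → ℤ
  degDiff v = + outdeg v - + indeg v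

-- An arrangement: a bijection V → positions. Positions are Fin n,
-- i.e. 0-based: vertex v sits at position toℕ (π ⟨$⟩ʳ v) + 1.
Arrangement : ℕ → Set
Arrangement n = Permutation′ n

pos : ∀ {n} → Arrangement n → Fin n → ℕ
pos π v = toℕ (π ⟨$⟩ʳ v)

-- c_i(π): number of edges with tail among the first i vertices and head
-- among the remaining ones (1-based position ≤ i  ⇔  pos < i).
cut : ∀ {n} → Digraph n → Arrangement n → ℕ → ℕ
cut {n} E π i = Σ[ n ] (λ u → Σ[ n ] (λ v → [ E u v ∧ (pos π u <ᵇ i) ∧ (i ≤ᵇ pos π v) ]))

Maximum : ∀ {n} → Digraph n → Arrangement n → Set
Maximum {n} E π = ∀ (σ : Arrangement n) (i : ℕ) → 1 ≤ i → i ≤ n ∸ 1 → cut E π i ≥ cut E σ i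

NonIncreasingDegDiff : ∀ {n} → Digraph n → Arrangement n → Set
NonIncreasingDegDiff {n} E π = ∀ u v → pos π u < pos π v → degDiff E u ≥ℤ degDiff E v

-- Think of the first i vertices of an arrangement as a set S of size i; the cut value is the
-- number of edges leaving S.  In a transitive acyclic digraph, whenever an edge p → s enters S,
-- exchanging s for p strictly increases the number of leaving edges, so some
-- predecessor-closed set of the same size is at least as good as S.  For a predecessor-closed S,
-- double counting gives  leaving(S) + n·|S| = Σ_{v∈S} w(v)  with  w = d⁺ + (n − d⁻),  and a set
-- of |S| vertices of largest w maximises the right-hand side.  Sorting by d⁺ − d⁻ is sorting by
-- w, and w strictly decreases along edges, so every prefix of π is both heaviest and
-- predecessor-closed.
module Submission where

open import Defs
open import Data.Bool using (Bool; true; false; not; _∧_; if_then_else_; T)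
open import Data.Bool.Properties using (∧-zeroʳ; ∧-identityʳ) renaming (_≟_ to _≟ᵇ_)
open import Data.Empty using (⊥; ⊥-elim)
open import Data.Fin using (Fin; zero; suc; toℕ; punchIn)
open import Data.Fin.Properties using (any?; punchInᵢ≢i) renaming (_≟_ to _≟ᶠ_)
open import Data.Fin.Permutation using (_⟨$⟩ʳ_)
open import Data.Integer as ℤ using (ℤ)
import Data.Integer.Properties as ℤ
open import Data.Integer.Tactic.RingSolver using (solve-∀)
open import Data.Nat using (ℕ; zero; suc; _+_; _*_; _∸_; _≤_; _<_; _<ᵇ_; _≤ᵇ_; z≤n; s≤s)
open import Data.Nat.Induction using (<-wellFounded)
open import Data.Nat.Properties
open import Data.Product using (∃; ∃₂; _×_; _,_)
open import Function using (_∘_)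
open import Induction.WellFounded using (Acc; acc)
open import Relation.Nullary using (¬_; Dec; yes; no; does)
open import Relation.Nullary.Decidable using (_×-dec_)
open import Relation.Binary.PropositionalEquality hiding ([_])
open import Algebra.Properties.CommutativeSemigroup +-commutativeSemigroup using (xy∙z≈xz∙y; xy∙z≈zy∙x)
open import Algebra.Properties.Semiring.Sum +-*-semiring
  using (sum; sum-remove; sum-cong-≗; ∑-distrib-+; ∑-comm; sum-permute; *-distribˡ-sum)

Σ≡sum : ∀ {n} (f : Fin n → ℕ) → Σ[ n ] f ≡ sum f
Σ≡sum {zero}  f = refl
Σ≡sum {suc n} f = cong (f zero +_) (Σ≡sum (f ∘ suc))

Σ-cong : ∀ {n} {f g : Fin n → ℕ} → (∀ i → f i ≡ g i) → Σ[ n ] f ≡ Σ[ n ] g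
Σ-cong {zero}  f≗g = refl
Σ-cong {suc n} f≗g = cong₂ _+_ (f≗g zero) (Σ-cong (f≗g ∘ suc))

Σ-const : ∀ n c → Σ[ n ] (λ _ → c) ≡ n * c
Σ-const zero    c = refl
Σ-const (suc n) c = cong (c +_) (Σ-const n c)

Σ-distrib-+ : ∀ {n} (f g : Fin n → ℕ) → Σ[ n ] (λ i → f i + g i) ≡ Σ[ n ] f + Σ[ n ] g
Σ-distrib-+ {n} f g = begin
  Σ[ n ] (λ i → f i + g i)  ≡⟨ Σ≡sum (λ i → f i + g i) ⟩
  sum {n} (λ i → f i + g i) ≡⟨ ∑-distrib-+ f g ⟩
  sum f + sum g             ≡⟨ sym (cong₂ _+_ (Σ≡sum f) (Σ≡sum g)) ⟩
  Σ[ n ] f + Σ[ n ] g       ∎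
  where open ≡-Reasoning

Σ-comm : ∀ {m n} (f : Fin m → Fin n → ℕ) →
         Σ[ m ] (λ i → Σ[ n ] (f i)) ≡ Σ[ n ] (λ j → Σ[ m ] (λ i → f i j))
Σ-comm {m} {n} f = begin
  Σ[ m ] (λ i → Σ[ n ] (f i))            ≡⟨ trans (Σ-cong (Σ≡sum ∘ f)) (Σ≡sum (λ i → sum (f i))) ⟩
  sum {m} (λ i → sum (f i))              ≡⟨ ∑-comm f ⟩
  sum {n} (λ j → sum {m} (λ i → f i j))  ≡⟨ sym (trans (Σ-cong (λ j → Σ≡sum (λ i → f i j))) (Σ≡sum (λ j → sum (λ i → f i j)))) ⟩
  Σ[ n ] (λ j → Σ[ m ] (λ i → f i j))    ∎
  where open ≡-Reasoning

Σ-mono-≤ : ∀ {n} {f g : Fin n → ℕ} → (∀ i → f i ≤ g i) → Σ[ n ] f ≤ Σ[ n ] g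
Σ-mono-≤ {zero}  f≤g = z≤n
Σ-mono-≤ {suc n} f≤g = +-mono-≤ (f≤g zero) (Σ-mono-≤ (f≤g ∘ suc))

Σ-mono-< : ∀ {n} {f g : Fin n → ℕ} → (∀ i → f i ≤ g i) → ∀ j → f j < g j → Σ[ n ] f < Σ[ n ] g
Σ-mono-< f≤g zero    fj<gj = +-mono-<-≤ fj<gj (Σ-mono-≤ (f≤g ∘ suc))
Σ-mono-< f≤g (suc j) fj<gj = +-mono-≤-< (f≤g zero) (Σ-mono-< (f≤g ∘ suc) j fj<gj)

Σ-bounded : ∀ {n} {f : Fin n → ℕ} {c} → (∀ i → f i ≤ c) → Σ[ n ] f ≤ n * c
Σ-bounded {n} {c = c} f≤c = ≤-trans (Σ-mono-≤ f≤c) (≤-reflexive (Σ-const n c))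

Σ-update : ∀ {n} (f g : Fin n → ℕ) x → (∀ i → i ≢ x → f i ≡ g i) → Σ[ n ] f + g x ≡ Σ[ n ] g + f x
Σ-update {suc n} f g x f≗g = begin
  Σ[ suc n ] f + g x                 ≡⟨ cong (_+ g x) (trans (Σ≡sum f) (sum-remove f)) ⟩
  f x + sum (f ∘ punchIn x) + g x    ≡⟨ cong (λ r → f x + r + g x) (sum-cong-≗ rest) ⟩
  f x + sum (g ∘ punchIn x) + g x    ≡⟨ xy∙z≈zy∙x (f x) _ (g x) ⟩
  g x + sum (g ∘ punchIn x) + f x    ≡⟨ cong (_+ f x) (sym (trans (Σ≡sum g) (sum-remove g))) ⟩
  Σ[ suc n ] g + f x                 ∎
  where
  open ≡-Reasoning
  rest : ∀ j → f (punchIn x j) ≡ g (punchIn x j)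
  rest j = f≗g (punchIn x j) (punchInᵢ≢i x j)

if-Σ : ∀ {n} b (f : Fin n → ℕ) → (if b then Σ[ n ] f else 0) ≡ Σ[ n ] (λ i → if b then f i else 0)
if-Σ {n} true  f = refl
if-Σ {n} false f = sym (trans (Σ-const n 0) (*-zeroʳ n))

[]-mono : ∀ {b c} → (b ≡ true → c ≡ true) → [ b ] ≤ [ c ]
[]-mono {false} b⇒c = z≤n
[]-mono {true}  b⇒c rewrite b⇒c refl = ≤-refl

[]-< : ∀ {b c} → b ≡ false → c ≡ true → [ b ] < [ c ]
[]-< refl refl = s≤s z≤n

[]-≤-1 : ∀ b → [ b ] ≤ 1
[]-≤-1 true  = ≤-refl
[]-≤-1 false = z≤n

[not]-antitone : ∀ {b c} → (c ≡ true → b ≡ true) → [ not b ] ≤ [ not c ]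
[not]-antitone {b} {true}  c⇒b rewrite c⇒b refl = z≤n
[not]-antitone {b} {false} c⇒b = []-≤-1 (not b)

[]+[not]≡1 : ∀ b → [ b ] + [ not b ] ≡ 1
[]+[not]≡1 true  = refl
[]+[not]≡1 false = refl

∧-true : ∀ {b c} → b ∧ c ≡ true → b ≡ true × c ≡ true
∧-true {true} {true} _ = refl , refl

not-true : ∀ {b} → not b ≡ true → b ≡ false
not-true {false} _ = refl

true≢false : true ≢ false
true≢false ()

Subset : ℕ → Set
Subset n = Fin n → Bool

module _ {n : ℕ} where

  sumOver : Subset n → (Fin n → ℕ) → ℕ
  sumOver S f = Σ[ n ] (λ u → if S u then f u else 0)

  size : Subset n → ℕ
  size S = sumOver S (λ _ → 1)

  _⊆_ : Subset n → Subset n → Set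
  S ⊆ T = ∀ u → S u ≡ true → T u ≡ true

  Heaviest : (Fin n → ℕ) → Subset n → Set
  Heaviest w P = ∀ u v → P u ≡ true → P v ≡ false → w v ≤ w u

  sumOver-cong : ∀ S {f g : Fin n → ℕ} → (∀ u → S u ≡ true → f u ≡ g u) → sumOver S f ≡ sumOver S g
  sumOver-cong S {f} {g} f≗g = Σ-cong pointwise
    where
    pointwise : ∀ u → (if S u then f u else 0) ≡ (if S u then g u else 0)
    pointwise u with S u in Su
    ... | true  = f≗g u Su
    ... | false = refl

  sumOver-≗ : ∀ {S T} (f : Fin n → ℕ) → (∀ u → S u ≡ T u) → sumOver S f ≡ sumOver T f
  sumOver-≗ f S≗T = Σ-cong (λ u → cong (λ b → if b then f u else 0) (S≗T u))

  sumOver-mono-≤ : ∀ S {f g : Fin n → ℕ} → (∀ u → S u ≡ true → f u ≤ g u) → sumOver S f ≤ sumOver S g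
  sumOver-mono-≤ S {f} {g} f≤g = Σ-mono-≤ pointwise
    where
    pointwise : ∀ u → (if S u then f u else 0) ≤ (if S u then g u else 0)
    pointwise u with S u in Su
    ... | true  = f≤g u Su
    ... | false = z≤n

  sumOver-bounded : ∀ S {f : Fin n → ℕ} {c} → (∀ u → f u ≤ c) → sumOver S f ≤ n * c
  sumOver-bounded S {f} {c} f≤c = Σ-bounded pointwise
    where
    pointwise : ∀ u → (if S u then f u else 0) ≤ c
    pointwise u with S u
    ... | true  = f≤c u
    ... | false = z≤n

  sumOver-distrib-+ : ∀ S (f g : Fin n → ℕ) → sumOver S (λ u → f u + g u) ≡ sumOver S f + sumOver S g
  sumOver-distrib-+ S f g =
    trans (Σ-cong pointwise) (Σ-distrib-+ (λ u → if S u then f u else 0) (λ u → if S u then g u else 0))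
    where
    pointwise : ∀ u → (if S u then f u + g u else 0) ≡ (if S u then f u else 0) + (if S u then g u else 0)
    pointwise u with S u
    ... | true  = refl
    ... | false = refl

  sumOver-const : ∀ S c → sumOver S (λ _ → c) ≡ c * size S
  sumOver-const S c = begin
    sumOver S (λ _ → c)                        ≡⟨ Σ-cong pointwise ⟩
    Σ[ n ] (λ u → c * (if S u then 1 else 0))  ≡⟨ Σ≡sum (λ u → c * (if S u then 1 else 0)) ⟩
    sum (λ u → c * (if S u then 1 else 0))     ≡⟨ *-distribˡ-sum c (λ u → if S u then 1 else 0) ⟨
    c * sum (λ u → if S u then 1 else 0)       ≡⟨ cong (c *_) (Σ≡sum (λ u → if S u then 1 else 0)) ⟨
    c * size S                                 ∎
    where
    open ≡-Reasoning
    pointwise : ∀ u → (if S u then c else 0) ≡ c * (if S u then 1 else 0)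
    pointwise u with S u
    ... | true  = sym (*-identityʳ c)
    ... | false = sym (*-zeroʳ c)

  sumOver-comm : ∀ S T (g : Fin n → Fin n → ℕ) →
                 sumOver S (λ u → sumOver T (g u)) ≡ sumOver T (λ v → sumOver S (λ u → g u v))
  sumOver-comm S T g = begin
    sumOver S (λ u → sumOver T (g u))
      ≡⟨ Σ-cong (λ u → if-Σ (S u) (λ v → if T v then g u v else 0)) ⟩
    Σ[ n ] (λ u → Σ[ n ] (λ v → if S u then (if T v then g u v else 0) else 0))
      ≡⟨ Σ-comm (λ u v → if S u then (if T v then g u v else 0) else 0) ⟩
    Σ[ n ] (λ v → Σ[ n ] (λ u → if S u then (if T v then g u v else 0) else 0))
      ≡⟨ Σ-cong (λ v → Σ-cong (λ u → if-swap (S u) (T v))) ⟩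
    Σ[ n ] (λ v → Σ[ n ] (λ u → if T v then (if S u then g u v else 0) else 0))
      ≡⟨ Σ-cong (λ v → if-Σ (T v) (λ u → if S u then g u v else 0)) ⟨
    sumOver T (λ v → sumOver S (λ u → g u v))
      ∎
    where
    open ≡-Reasoning
    if-swap : ∀ b c {x : ℕ} → (if b then (if c then x else 0) else 0) ≡ (if c then (if b then x else 0) else 0)
    if-swap true  true  = refl
    if-swap true  false = refl
    if-swap false true  = refl
    if-swap false false = refl

  ⊆-size-< : ∀ {S T p} → S ⊆ T → T p ≡ true → S p ≡ false → size S < size T
  ⊆-size-< {S} {T} {p} S⊆T Tp Sp =
    Σ-mono-< pointwise p (subst₂ (λ b c → (if b then 1 else 0) < (if c then 1 else 0)) (sym Sp) (sym Tp) ≤-refl)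
    where
    pointwise : ∀ u → (if S u then 1 else 0) ≤ (if T u then 1 else 0)
    pointwise u with S u in Su
    ... | true  rewrite S⊆T u Su = ≤-refl
    ... | false = z≤n

  ⊆-antisym : ∀ {S T} → S ⊆ T → T ⊆ S → ∀ u → S u ≡ T u
  ⊆-antisym {S} {T} S⊆T T⊆S u with S u in Su | T u in Tu
  ... | true  | true  = refl
  ... | false | false = refl
  ... | true  | false = ⊥-elim (true≢false (trans (sym (S⊆T u Su)) Tu))
  ... | false | true  = ⊥-elim (true≢false (trans (sym (T⊆S u Tu)) Su))

  difference? : (S T : Subset n) → Dec (∃ λ u → S u ≡ true × T u ≡ false)
  difference? S T = any? (λ u → (S u ≟ᵇ true) ×-dec (T u ≟ᵇ false))

  ¬difference⇒⊆ : ∀ {S T} → ¬ (∃ λ u → S u ≡ true × T u ≡ false) → S ⊆ T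
  ¬difference⇒⊆ {S} {T} ¬diff u Su with T u in Tu
  ... | true  = refl
  ... | false = ⊥-elim (¬diff (u , Su , Tu))

  record Insertion (S : Subset n) (x : Fin n) (T : Subset n) : Set where
    field
      absent  : S x ≡ false
      present : T x ≡ true
      agree   : ∀ v → v ≢ x → T v ≡ S v

  sumOver-insertion : ∀ {S x T} → Insertion S x T → (f : Fin n → ℕ) → sumOver T f ≡ sumOver S f + f x
  sumOver-insertion {S} {x} {T} ins f = begin
    sumOver T f                                  ≡⟨ +-identityʳ _ ⟨
    sumOver T f + 0                              ≡⟨ cong (λ b → sumOver T f + (if b then f x else 0)) absent ⟨
    sumOver T f + (if S x then f x else 0)       ≡⟨ Σ-update _ _ x (λ v v≢x → cong (λ b → if b then f v else 0) (agree v v≢x)) ⟩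
    sumOver S f + (if T x then f x else 0)       ≡⟨ cong (λ b → sumOver S f + (if b then f x else 0)) present ⟩
    sumOver S f + f x                            ∎
    where
    open ≡-Reasoning
    open Insertion ins

  update : Subset n → Fin n → Bool → Subset n
  update S x b v = if does (v ≟ᶠ x) then b else S v

  update-≡ : ∀ S x b → update S x b x ≡ b
  update-≡ S x b with x ≟ᶠ x
  ... | yes _   = refl
  ... | no x≢x = ⊥-elim (x≢x refl)

  update-≢ : ∀ S {x} b {v} → v ≢ x → update S x b v ≡ S v
  update-≢ S {x} b {v} v≢x with v ≟ᶠ x
  ... | yes v≡x = ⊥-elim (v≢x v≡x)
  ... | no _    = refl

  update-preserves-false : ∀ S {x v} → S v ≡ false → update S x false v ≡ false
  update-preserves-false S {x} {v} Sv with v ≟ᶠ x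
  ... | yes _ = refl
  ... | no _  = Sv

  insertion-add : ∀ {S x} → S x ≡ false → Insertion S x (update S x true)
  insertion-add {S} {x} Sx = record
    { absent = Sx ; present = update-≡ S x true ; agree = λ v → update-≢ S true }

  insertion-remove : ∀ {S x} → S x ≡ true → Insertion (update S x false) x S
  insertion-remove {S} {x} Sx = record
    { absent = update-≡ S x false ; present = Sx ; agree = λ v v≢x → sym (update-≢ S false v≢x) }

  exchange : Subset n → Fin n → Fin n → Subset n
  exchange S s p = update (update S s false) p true

  module _ {S : Subset n} {s p : Fin n} (Ss : S s ≡ true) (Sp : S p ≡ false) where

    private
      S₀ : Subset n
      S₀ = update S s false

    p≢s : p ≢ s
    p≢s p≡s = true≢false (trans (sym Ss) (trans (cong S (sym p≡s)) Sp))

    exchange-remove : Insertion S₀ s S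
    exchange-remove = insertion-remove Ss

    exchange-add : Insertion S₀ p (exchange S s p)
    exchange-add = insertion-add (trans (update-≢ S false p≢s) Sp)

    sumOver-exchange : ∀ f → sumOver (exchange S s p) f + f s ≡ sumOver S f + f p
    sumOver-exchange f = begin
      sumOver (exchange S s p) f + f s  ≡⟨ cong (_+ f s) (sumOver-insertion exchange-add f) ⟩
      sumOver S₀ f + f p + f s          ≡⟨ xy∙z≈xz∙y (sumOver S₀ f) (f p) (f s) ⟩
      sumOver S₀ f + f s + f p          ≡⟨ cong (_+ f p) (sumOver-insertion exchange-remove f) ⟨
      sumOver S f + f p                 ∎
      where open ≡-Reasoning

    size-exchange : size (exchange S s p) ≡ size S
    size-exchange = +-cancelʳ-≡ 1 _ _ (sumOver-exchange (λ _ → 1))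

  module _ (w : Fin n → ℕ) {P : Subset n} (heaviest : Heaviest w P) where

    sumOver-≤-heaviest : ∀ S → size S ≡ size P → sumOver S w ≤ sumOver P w
    sumOver-≤-heaviest S = go S (<-wellFounded (excess S))
      where
      excess : Subset n → ℕ
      excess S = sumOver S (λ u → [ not (P u) ])

      go : ∀ S → Acc _<_ (excess S) → size S ≡ size P → sumOver S w ≤ sumOver P w
      go S (acc rec) |S|≡|P| with difference? S P | difference? P S
      ... | no ¬S∖P | no ¬P∖S =
        ≤-reflexive (sumOver-≗ w (⊆-antisym (¬difference⇒⊆ ¬S∖P) (¬difference⇒⊆ ¬P∖S)))
      ... | yes (s , Ss , Ps) | no ¬P∖S =
        ⊥-elim (<⇒≢ (⊆-size-< (¬difference⇒⊆ ¬P∖S) Ss Ps) (sym |S|≡|P|))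
      ... | no ¬S∖P | yes (p , Pp , Sp) =
        ⊥-elim (<⇒≢ (⊆-size-< (¬difference⇒⊆ ¬S∖P) Pp Sp) |S|≡|P|)
      ... | yes (s , Ss , Ps) | yes (p , Pp , Sp) =
        ≤-trans exchange-heavier (go S' (rec excess-decreases) (trans (size-exchange Ss Sp) |S|≡|P|))
        where
        S' = exchange S s p

        exchange-heavier : sumOver S w ≤ sumOver S' w
        exchange-heavier = +-cancelʳ-≤ (w p) _ _ (begin
          sumOver S w + w p   ≡⟨ sumOver-exchange Ss Sp w ⟨
          sumOver S' w + w s  ≤⟨ +-monoʳ-≤ (sumOver S' w) (heaviest p s Pp Ps) ⟩
          sumOver S' w + w p  ∎)
          where open ≤-Reasoning

        excess-decreases : excess S' < excess S
        excess-decreases = ≤-reflexive (begin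
          suc (excess S')            ≡⟨ +-comm 1 (excess S') ⟩
          excess S' + 1              ≡⟨ cong (λ b → excess S' + [ not b ]) Ps ⟨
          excess S' + [ not (P s) ]  ≡⟨ sumOver-exchange Ss Sp (λ u → [ not (P u) ]) ⟩
          excess S + [ not (P p) ]   ≡⟨ cong (λ b → excess S + [ not b ]) Pp ⟩
          excess S + 0               ≡⟨ +-comm (excess S) 0 ⟩
          excess S                   ∎)
          where open ≡-Reasoning

module _ {n : ℕ} (E : Digraph n) where

  edgesTo : Subset n → Fin n → ℕ
  edgesTo S v = sumOver S (λ u → [ E u v ])

  edgesOut : Fin n → Subset n → ℕ
  edgesOut u S = Σ[ n ] (λ v → [ E u v ∧ not (S v) ])

  leaving : Subset n → ℕ
  leaving S = sumOver S (λ u → edgesOut u S)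

  internal : Subset n → ℕ
  internal S = sumOver S (edgesTo S)

  PredClosed : Subset n → Set
  PredClosed S = ∀ u v → E u v ≡ true → S v ≡ true → S u ≡ true

  -- n − d⁻(v), counted directly so that the weight below stays in ℕ.
  nonInDeg : Fin n → ℕ
  nonInDeg v = Σ[ n ] (λ u → [ not (E u v) ])

  weight : Fin n → ℕ
  weight v = outdeg E v + nonInDeg v

  outdeg-split : ∀ S u → outdeg E u ≡ sumOver S (λ v → [ E u v ]) + edgesOut u S
  outdeg-split S u =
    trans (Σ-cong (λ v → split (E u v) (S v)))
          (Σ-distrib-+ (λ v → if S v then [ E u v ] else 0) (λ v → [ E u v ∧ not (S v) ]))
    where
    split : ∀ b c → [ b ] ≡ (if c then [ b ] else 0) + [ b ∧ not c ]
    split true  true  = refl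
    split true  false = refl
    split false true  = refl
    split false false = refl

  sumOver-outdeg : ∀ S → sumOver S (outdeg E) ≡ internal S + leaving S
  sumOver-outdeg S = begin
    sumOver S (outdeg E)
      ≡⟨ sumOver-cong S (λ u _ → outdeg-split S u) ⟩
    sumOver S (λ u → sumOver S (λ v → [ E u v ]) + edgesOut u S)
      ≡⟨ sumOver-distrib-+ S (λ u → sumOver S (λ v → [ E u v ])) (λ u → edgesOut u S) ⟩
    sumOver S (λ u → sumOver S (λ v → [ E u v ])) + leaving S
      ≡⟨ cong (_+ leaving S) (sumOver-comm S S (λ u v → [ E u v ])) ⟩
    internal S + leaving S
      ∎
    where open ≡-Reasoning

  sumOver-indeg : ∀ {S} → PredClosed S → sumOver S (indeg E) ≡ internal S
  sumOver-indeg {S} closed = sumOver-cong S (λ v Sv → Σ-cong (λ u → from-S u v Sv))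
    where
    from-S : ∀ u v → S v ≡ true → [ E u v ] ≡ (if S u then [ E u v ] else 0)
    from-S u v Sv with S u in Su | E u v in Euv
    ... | true  | _     = refl
    ... | false | false = refl
    ... | false | true  = ⊥-elim (true≢false (trans (sym (closed u v Euv Sv)) Su))

  indeg+nonInDeg : ∀ v → indeg E v + nonInDeg v ≡ n
  indeg+nonInDeg v = begin
    indeg E v + nonInDeg v                       ≡⟨ Σ-distrib-+ (λ u → [ E u v ]) (λ u → [ not (E u v) ]) ⟨
    Σ[ n ] (λ u → [ E u v ] + [ not (E u v) ])   ≡⟨ Σ-cong (λ u → []+[not]≡1 (E u v)) ⟩
    Σ[ n ] (λ _ → 1)                             ≡⟨ Σ-const n 1 ⟩
    n * 1                                        ≡⟨ *-identityʳ n ⟩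
    n                                            ∎
    where open ≡-Reasoning

  weight+indeg : ∀ v → weight v + indeg E v ≡ outdeg E v + n
  weight+indeg v =
    trans (+-assoc (outdeg E v) _ _) (cong (outdeg E v +_) (trans (+-comm (nonInDeg v) _) (indeg+nonInDeg v)))

  leaving+n*size : ∀ {S} → PredClosed S → leaving S + n * size S ≡ sumOver S weight
  leaving+n*size {S} closed = +-cancelʳ-≡ (sumOver S (indeg E)) _ _ (begin
    leaving S + n * size S + sumOver S (indeg E)    ≡⟨ xy∙z≈xz∙y (leaving S) _ _ ⟩
    leaving S + sumOver S (indeg E) + n * size S    ≡⟨ cong (λ m → leaving S + m + n * size S) (sumOver-indeg closed) ⟩
    leaving S + internal S + n * size S             ≡⟨ cong (λ m → m + n * size S) (trans (+-comm (leaving S) _) (sym (sumOver-outdeg S))) ⟩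
    sumOver S (outdeg E) + n * size S               ≡⟨ cong (sumOver S (outdeg E) +_) (sumOver-const S n) ⟨
    sumOver S (outdeg E) + sumOver S (λ _ → n)      ≡⟨ sumOver-distrib-+ S (outdeg E) (λ _ → n) ⟨
    sumOver S (λ v → outdeg E v + n)                ≡⟨ sumOver-cong S (λ v _ → weight+indeg v) ⟨
    sumOver S (λ v → weight v + indeg E v)          ≡⟨ sumOver-distrib-+ S weight (indeg E) ⟩
    sumOver S weight + sumOver S (indeg E)          ∎)
    where open ≡-Reasoning

  +weight≡degDiff+n : ∀ v → ℤ.+ weight v ≡ degDiff E v ℤ.+ ℤ.+ n
  +weight≡degDiff+n v = begin
    ℤ.+ weight v                                          ≡⟨ shift (ℤ.+ outdeg E v) (ℤ.+ indeg E v) (ℤ.+ nonInDeg v) ⟩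
    degDiff E v ℤ.+ (ℤ.+ indeg E v ℤ.+ ℤ.+ nonInDeg v)    ≡⟨ cong (λ m → degDiff E v ℤ.+ ℤ.+ m) (indeg+nonInDeg v) ⟩
    degDiff E v ℤ.+ ℤ.+ n                                 ∎
    where
    open ≡-Reasoning
    shift : ∀ (o i j : ℤ) → o ℤ.+ j ≡ (o ℤ.- i) ℤ.+ (i ℤ.+ j)
    shift = solve-∀

  weight-mono : ∀ {u v} → degDiff E v ℤ.≤ degDiff E u → weight v ≤ weight u
  weight-mono {u} {v} le =
    ℤ.drop‿+≤+ (subst₂ ℤ._≤_ (sym (+weight≡degDiff+n v)) (sym (+weight≡degDiff+n u)) (ℤ.+-monoˡ-≤ (ℤ.+ n) le))

  edgesOut-insertion : ∀ {S x T} → Insertion S x T → ∀ u → edgesOut u S ≡ edgesOut u T + [ E u x ]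
  edgesOut-insertion {S} {x} {T} ins u = begin
    edgesOut u S                          ≡⟨ +-identityʳ _ ⟨
    edgesOut u S + 0
      ≡⟨ cong (λ b → edgesOut u S + [ b ]) (trans (cong (λ c → E u x ∧ not c) present) (∧-zeroʳ (E u x))) ⟨
    edgesOut u S + [ E u x ∧ not (T x) ]
      ≡⟨ Σ-update _ _ x (λ v v≢x → cong (λ c → [ E u v ∧ not c ]) (sym (agree v v≢x))) ⟩
    edgesOut u T + [ E u x ∧ not (S x) ]  ≡⟨ cong (λ c → edgesOut u T + [ E u x ∧ not c ]) absent ⟩
    edgesOut u T + [ E u x ∧ true ]       ≡⟨ cong (λ b → edgesOut u T + [ b ]) (∧-identityʳ (E u x)) ⟩
    edgesOut u T + [ E u x ]              ∎
    where
    open ≡-Reasoning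
    open Insertion ins

  leaving-insertion : ∀ {S x T} → Insertion S x T → leaving T + edgesTo S x ≡ leaving S + edgesOut x T
  leaving-insertion {S} {x} {T} ins = begin
    leaving T + edgesTo S x
      ≡⟨ cong (_+ edgesTo S x) (sumOver-insertion ins (λ u → edgesOut u T)) ⟩
    sumOver S (λ u → edgesOut u T) + edgesOut x T + edgesTo S x
      ≡⟨ xy∙z≈xz∙y (sumOver S (λ u → edgesOut u T)) _ _ ⟩
    sumOver S (λ u → edgesOut u T) + edgesTo S x + edgesOut x T
      ≡⟨ cong (_+ edgesOut x T) (sumOver-distrib-+ S (λ u → edgesOut u T) (λ u → [ E u x ])) ⟨
    sumOver S (λ u → edgesOut u T + [ E u x ]) + edgesOut x T
      ≡⟨ cong (_+ edgesOut x T) (sumOver-cong S (λ u _ → edgesOut-insertion ins u)) ⟨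
    leaving S + edgesOut x T
      ∎
    where open ≡-Reasoning

  leaving-bounded : ∀ S → leaving S ≤ n * n
  leaving-bounded S =
    sumOver-bounded S (λ u → ≤-trans (Σ-bounded {n} (λ v → []-≤-1 (E u v ∧ not (S v)))) (≤-reflexive (*-identityʳ n)))

  entering? : (S : Subset n) → Dec (∃₂ λ u v → E u v ≡ true × S u ≡ false × S v ≡ true)
  entering? S = any? (λ u → any? (λ v → (E u v ≟ᵇ true) ×-dec (S u ≟ᵇ false) ×-dec (S v ≟ᵇ true)))

  ¬entering⇒closed : ∀ {S} → ¬ (∃₂ λ u v → E u v ≡ true × S u ≡ false × S v ≡ true) → PredClosed S
  ¬entering⇒closed {S} ¬entering u v Euv Sv with S u in Su
  ... | true  = refl
  ... | false = ⊥-elim (¬entering (u , v , Euv , Su , Sv))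

module _ {n : ℕ} {E : Digraph n} (transitive : Transitive E) (acyclic : Acyclic E) where

  loopless : ∀ v → E v v ≡ false
  loopless v with E v v in Evv
  ... | true  = ⊥-elim (acyclic v (edge Evv))
  ... | false = refl

  asymmetric : ∀ {u v} → E u v ≡ true → E v u ≡ true → ⊥
  asymmetric {u} Euv Evu = acyclic u (Euv ∷ edge Evu)

  edge-target-≢ : ∀ {u v w} → E u v ≡ true → E v w ≡ true → u ≢ w
  edge-target-≢ Euv Evw refl = asymmetric Euv Evw

  outdeg-decreasing : ∀ {u v} → E u v ≡ true → outdeg E v < outdeg E u
  outdeg-decreasing {u} {v} Euv =
    Σ-mono-< (λ w → []-mono (λ Evw → transitive u v w Euv Evw (edge-target-≢ Euv Evw))) v ([]-< (loopless v) Euv)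

  nonInDeg-decreasing : ∀ {u v} → E u v ≡ true → nonInDeg E v < nonInDeg E u
  nonInDeg-decreasing {u} {v} Euv =
    Σ-mono-< (λ w → [not]-antitone (λ Ewu → transitive w u v Ewu Euv (edge-target-≢ Ewu Euv))) u
             ([]-< (cong not Euv) (cong not (loopless u)))

  weight-decreasing : ∀ {u v} → E u v ≡ true → weight E v < weight E u
  weight-decreasing Euv = +-mono-< (outdeg-decreasing Euv) (nonInDeg-decreasing Euv)

  heaviest-closed : ∀ {P} → Heaviest (weight E) P → PredClosed E P
  heaviest-closed {P} heaviest u v Euv Pv with P u in Pu
  ... | true  = refl
  ... | false = ⊥-elim (<⇒≱ (weight-decreasing Euv) (heaviest v u Pv Pu))

  edgesTo-mono : ∀ {S p s} → E p s ≡ true → S s ≡ false → edgesTo E S p ≤ edgesTo E S s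
  edgesTo-mono {S} {p} {s} Eps Ss = sumOver-mono-≤ S (λ u Su → []-mono (λ Eup → transitive u p s Eup Eps (u≢s Su)))
    where
    u≢s : ∀ {u} → S u ≡ true → u ≢ s
    u≢s Su refl = true≢false (trans (sym Su) Ss)

  edgesOut-< : ∀ {S T p s} → E p s ≡ true → T s ≡ false → (∀ v → v ≢ p → S v ≡ false → T v ≡ false) →
               edgesOut E s S < edgesOut E p T
  edgesOut-< {S} {T} {p} {s} Eps Ts outside =
    Σ-mono-< (λ v → []-mono (pointwise v)) s ([]-< (cong (_∧ not (S s)) (loopless s)) (cong₂ (λ a b → a ∧ not b) Eps Ts))
    where
    pointwise : ∀ v → E s v ∧ not (S v) ≡ true → E p v ∧ not (T v) ≡ true
    pointwise v e with ∧-true e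
    ... | Esv , ¬Sv = cong₂ (λ a b → a ∧ not b) (transitive p s v Eps Esv p≢v) (outside v (p≢v ∘ sym) (not-true ¬Sv))
      where
      p≢v : p ≢ v
      p≢v = edge-target-≢ Eps Esv

  -- Every edge from S₀ = S ∖ {s} into p continues to s, and p reaches every out-neighbour of s
  -- outside S, and s itself: so removing s loses fewer edges than adding p gains.
  leaving-exchange-< : ∀ {S p s} → E p s ≡ true → S s ≡ true → S p ≡ false → leaving E S < leaving E (exchange S s p)
  leaving-exchange-< {S} {p} {s} Eps Ss Sp = +-cancelʳ-< (edgesTo E S₀ p) _ _ (begin-strict
    leaving E S + edgesTo E S₀ p    ≤⟨ +-monoʳ-≤ (leaving E S) (edgesTo-mono Eps (Insertion.absent removal)) ⟩
    leaving E S + edgesTo E S₀ s    ≡⟨ leaving-insertion E removal ⟩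
    leaving E S₀ + edgesOut E s S   <⟨ +-monoʳ-< (leaving E S₀) (edgesOut-< Eps S's outside) ⟩
    leaving E S₀ + edgesOut E p S'  ≡⟨ leaving-insertion E addition ⟨
    leaving E S' + edgesTo E S₀ p   ∎)
    where
    open ≤-Reasoning
    S₀ = update S s false
    S' = exchange S s p
    removal = exchange-remove Ss Sp
    addition = exchange-add Ss Sp
    S's : S' s ≡ false
    S's = trans (update-≢ S₀ true (p≢s Ss Sp ∘ sym)) (Insertion.absent removal)
    outside : ∀ v → v ≢ p → S v ≡ false → S' v ≡ false
    outside v v≢p Sv = trans (update-≢ S₀ true v≢p) (update-preserves-false S Sv)

  closed-dominator : ∀ S → ∃ λ T → PredClosed E T × size T ≡ size S × leaving E S ≤ leaving E T
  closed-dominator S = go S (<-wellFounded (n * n ∸ leaving E S))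
    where
    go : ∀ S → Acc _<_ (n * n ∸ leaving E S) → ∃ λ T → PredClosed E T × size T ≡ size S × leaving E S ≤ leaving E T
    go S (acc rec) with entering? E S
    ... | no ¬entering = S , ¬entering⇒closed E ¬entering , refl , ≤-refl
    ... | yes (p , s , Eps , Sp , Ss) =
      let T , closedT , |T|≡|S'| , S'≤T = go S' (rec (∸-monoʳ-< grows (leaving-bounded E S')))
      in  T , closedT , trans |T|≡|S'| (size-exchange {S = S} Ss Sp) , ≤-trans (<⇒≤ grows) S'≤T
      where
      S' = exchange S s p
      grows : leaving E S < leaving E S'
      grows = leaving-exchange-< Eps Ss Sp

  leaving-≤-heaviest : ∀ {P} → Heaviest (weight E) P → ∀ S → size S ≡ size P → leaving E S ≤ leaving E P
  leaving-≤-heaviest {P} heaviest S |S|≡|P| with closed-dominator S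
  ... | T , closedT , |T|≡|S| , S≤T = ≤-trans S≤T (+-cancelʳ-≤ (n * size P) _ _ (begin
    leaving E T + n * size P  ≡⟨ cong (λ k → leaving E T + n * k) (trans |T|≡|S| |S|≡|P|) ⟨
    leaving E T + n * size T  ≡⟨ leaving+n*size E closedT ⟩
    sumOver T (weight E)      ≤⟨ sumOver-≤-heaviest (weight E) heaviest T (trans |T|≡|S| |S|≡|P|) ⟩
    sumOver P (weight E)      ≡⟨ leaving+n*size E (heaviest-closed heaviest) ⟨
    leaving E P + n * size P  ∎))
    where open ≤-Reasoning

prefix : ∀ {n} → Arrangement n → ℕ → Subset n
prefix ρ i v = pos ρ v <ᵇ i

≤ᵇ≡not<ᵇ : ∀ m n → (m ≤ᵇ n) ≡ not (n <ᵇ m)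
≤ᵇ≡not<ᵇ zero           n       = refl
≤ᵇ≡not<ᵇ (suc m)        zero    = refl
≤ᵇ≡not<ᵇ (suc zero)     (suc n) = refl
≤ᵇ≡not<ᵇ (suc (suc m))  (suc n) = ≤ᵇ≡not<ᵇ (suc m) n

<ᵇ-true⇒< : ∀ {m n} → (m <ᵇ n) ≡ true → m < n
<ᵇ-true⇒< {m} {n} m<ᵇn = <ᵇ⇒< m n (subst T (sym m<ᵇn) _)

<ᵇ-false⇒≥ : ∀ {m n} → (m <ᵇ n) ≡ false → n ≤ m
<ᵇ-false⇒≥ m≮ᵇn = ≮⇒≥ (λ m<n → subst T m≮ᵇn (<⇒<ᵇ m<n))

cut≡leaving-prefix : ∀ {n} (E : Digraph n) ρ i → cut E ρ i ≡ leaving E (prefix ρ i)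
cut≡leaving-prefix {n} E ρ i = Σ-cong row
  where
  P = prefix ρ i

  select : ∀ a b c → [ a ∧ b ∧ c ] ≡ (if b then [ a ∧ c ] else 0)
  select a true  c = refl
  select a false c = cong [_] (∧-zeroʳ a)

  row : ∀ u → Σ[ n ] (λ v → [ E u v ∧ P u ∧ (i ≤ᵇ pos ρ v) ]) ≡ (if P u then edgesOut E u P else 0)
  row u = begin
    Σ[ n ] (λ v → [ E u v ∧ P u ∧ (i ≤ᵇ pos ρ v) ])           ≡⟨ Σ-cong (λ v → select (E u v) (P u) _) ⟩
    Σ[ n ] (λ v → if P u then [ E u v ∧ (i ≤ᵇ pos ρ v) ] else 0) ≡⟨ if-Σ (P u) (λ v → [ E u v ∧ (i ≤ᵇ pos ρ v) ]) ⟨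
    (if P u then Σ[ n ] (λ v → [ E u v ∧ (i ≤ᵇ pos ρ v) ]) else 0)
      ≡⟨ cong (λ k → if P u then k else 0) (Σ-cong (λ v → cong (λ c → [ E u v ∧ c ]) (≤ᵇ≡not<ᵇ i (pos ρ v)))) ⟩
    (if P u then edgesOut E u P else 0)                        ∎
    where open ≡-Reasoning

size-prefix : ∀ {n} (ρ σ : Arrangement n) i → size (prefix ρ i) ≡ size (prefix σ i)
size-prefix {n} ρ σ i = trans (positions ρ) (sym (positions σ))
  where
  below : Fin n → ℕ
  below j = if toℕ j <ᵇ i then 1 else 0

  positions : ∀ τ → size (prefix τ i) ≡ Σ[ n ] below
  positions τ = trans (Σ≡sum (below ∘ (τ ⟨$⟩ʳ_))) (sym (trans (Σ≡sum below) (sum-permute below τ)))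

prefix-heaviest : ∀ {n} (E : Digraph n) π i → NonIncreasingDegDiff E π → Heaviest (weight E) (prefix π i)
prefix-heaviest E π i sorted u v u∈P v∉P =
  weight-mono E (sorted u v (<-≤-trans (<ᵇ-true⇒< {n = i} u∈P) (<ᵇ-false⇒≥ {n = i} v∉P)))

theorem5p1 : (n : ℕ) (E : Digraph n) → Transitive E → Acyclic E → (π : Arrangement n) → NonIncreasingDegDiff E π → Maximum E π
theorem5p1 n E transitive acyclic π sorted σ i _ _ =
  subst₂ _≤_ (sym (cut≡leaving-prefix E σ i)) (sym (cut≡leaving-prefix E π i))
    (leaving-≤-heaviest transitive acyclic (prefix-heaviest E π i sorted) (prefix σ i) (size-prefix σ π i))
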